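{- Let $S_1=(\{1,2,3\},\{\emptyset,\{1,2\},\{1,3\},\{2,3\},\{1,2,3\}\})$, $S_2=(\{1,2,3\},\{\emptyset,\{1\},\{2\},\{3\},\{1,2\},\{1,3\},\{2,3\}\})$, $S_3=(\{1,2,3\},\{\emptyset,\{2\},\{3\},\{1,2\},\{1,3\},\{1,2,3\}\})$, $S_5=(\{1,2,3,4\},\{\emptyset,\{1,2\},\{1,4\},\{2,3\},\{3,4\},\{1,2,3,4\}\})$. None of the delta-matroids $S_1$, $S_2$, $S_3$, $S_5$ belongs to a class of delta-matroids stable under handle slides.
   Context: A set system is a pair $(E,\mathcal{F})$ with $E$ finite and $\mathcal{F}$ a nonempty collection of subsets of $E$. A delta-matroid is a set system satisfying the symmetric exchange axiom: for all $F_1,F_2\in\mathcal{F}$ and $x\in F_1\Delta F_2$ there is $y\in F_1\Delta F_2$ with $F_1\Delta\{x,y\}\in\mathcal{F}$. For a set system $D=(E,\mathcal{F})$ and $a,b\in E$ with $a\neq b$, the handle slide of $a$ over $b$ is $D_{ab}=(E,\mathcal{F}_{ab})$ where $\mathcal{F}_{ab}=\mathcal{F}\,\Delta\,\{X\cup\{a\} : X\cup\{b\}\in\mathcal{F},\ X\subseteq E-\{a,b\}\}$. A delta-matroid $D=(E,\mathcal{F})$ is said to belong to a class of delta-matroids closed (stable) under handle slides if and only if for every finite sequence of handle slides, $(\cdots((D_{a_1b_1})_{a_2b_2})\cdots)_{a_nb_n}$ is a delta-matroid belonging to the same class, for all $a_1,b_1,\dots,a_n,b_n\in E$ with $a_i\neq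 b_i$. -}

module Defs where

open import Data.Bool using (Bool; true; false; _∧_; _∨_; not; _xor_; T)
open import Data.Fin using (Fin; zero; suc)
open import Data.Fin.Subset using (Subset; _∈_; _∪_; ⁅_⁆; _-_; ⊥)
open import Data.Vec using (Vec; lookup; zipWith)
open import Data.Vec.Properties using (≡-dec)
open import Data.Bool.Properties renaming (_≟_ to _≟B_)
open import Data.List using (List; []; _∷_; foldr)
open import Data.Bool.ListAction using (any)
open import Data.Nat using (ℕ)
open import Data.Product using (Σ; _×_; _,_; ∃)
open import Relation.Nullary using (¬_; does)
open import Relation.Binary.PropositionalEquality using (_≡_; _≢_)

Family : ℕ → Set
Family n = Subset n → Bool

_∈𝓕_ : ∀ {n} → Subset n → Family n → Set
X ∈𝓕 𝓕 = T (𝓕 X)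

_Δ_ : ∀ {n} → Subset n → Subset n → Subset n
A Δ B = zipWith _xor_ A B

_Δ𝓕_ : ∀ {n} → Family n → Family n → Family n
(𝓕 Δ𝓕 𝓖) Y = 𝓕 Y xor 𝓖 Y

IsDeltaMatroid : ∀ {n} → Family n → Set
IsDeltaMatroid {n} 𝓕 =
  (∃ λ (F : Subset n) → F ∈𝓕 𝓕) ×
  (∀ (F₁ F₂ : Subset n) → F₁ ∈𝓕 𝓕 → F₂ ∈𝓕 𝓕 → ∀ (x : Fin n) → x ∈ (F₁ Δ F₂) →
     ∃ λ (y : Fin n) → y ∈ (F₁ Δ F₂) × ((F₁ Δ (⁅ x ⁆ ∪ ⁅ y ⁆)) ∈𝓕 𝓕))

-- The family {X ∪ {a} : X ∪ {b} ∈ 𝓕, X ⊆ E - {a,b}}.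
-- Y lies in it iff a ∈ Y, b ∉ Y and (Y - a) ∪ {b} ∈ 𝓕 (then X = Y - a).
slideAdd : ∀ {n} → Family n → Fin n → Fin n → Family n
slideAdd 𝓕 a b Y = lookup Y a ∧ not (lookup Y b) ∧ 𝓕 ((Y - a) ∪ ⁅ b ⁆)

handleSlide : ∀ {n} → Family n → Fin n → Fin n → Family n
handleSlide 𝓕 a b = 𝓕 Δ𝓕 slideAdd 𝓕 a b

HS : ℕ → Set
HS n = Σ (Fin n) λ a → Σ (Fin n) λ b → a ≢ b

slides : ∀ {n} → Family n → List (HS n) → Family n
slides 𝓕 [] = 𝓕
slides 𝓕 ((a , b , _) ∷ s) = slides (handleSlide 𝓕 a b) s

-- D belongs to a class of delta-matroids stable under handle slides
-- iff every finite sequence of handle slides yields a delta-matroid.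
StableUnderHandleSlides : ∀ {n} → Family n → Set
StableUnderHandleSlides {n} 𝓕 = ∀ (s : List (HS n)) → IsDeltaMatroid (slides 𝓕 s)

set : ∀ {n} → List (Fin n) → Subset n
set = foldr (λ i X → ⁅ i ⁆ ∪ X) ⊥

familyOf : ∀ {n} → List (List (Fin n)) → Family n
familyOf L Y = any (λ xs → does (≡-dec _≟B_ (set xs) Y)) L

-- ground set element k (1-based in the paper) is Fin element k-1
e1 : ∀ {n} → Fin (Data.Nat.suc n)
e1 = zero
e2 : ∀ {n} → Fin (Data.Nat.suc (Data.Nat.suc n))
e2 = suc zero
e3 : ∀ {n} → Fin (Data.Nat.suc (Data.Nat.suc (Data.Nat.suc n)))
e3 = suc (suc zero)
e4 : Fin 4
e4 = suc (suc (suc zero))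

S₁ : Family 3
S₁ = familyOf ([] ∷ (e1 ∷ e2 ∷ []) ∷ (e1 ∷ e3 ∷ []) ∷ (e2 ∷ e3 ∷ []) ∷ (e1 ∷ e2 ∷ e3 ∷ []) ∷ [])

S₂ : Family 3
S₂ = familyOf ([] ∷ (e1 ∷ []) ∷ (e2 ∷ []) ∷ (e3 ∷ []) ∷ (e1 ∷ e2 ∷ []) ∷ (e1 ∷ e3 ∷ []) ∷ (e2 ∷ e3 ∷ []) ∷ [])

S₃ : Family 3
S₃ = familyOf ([] ∷ (e2 ∷ []) ∷ (e3 ∷ []) ∷ (e1 ∷ e2 ∷ []) ∷ (e1 ∷ e3 ∷ []) ∷ (e1 ∷ e2 ∷ e3 ∷ []) ∷ [])

S₅ : Family 4
S₅ = familyOf ([] ∷ (e1 ∷ e2 ∷ []) ∷ (e1 ∷ e4 ∷ []) ∷ (e2 ∷ e3 ∷ []) ∷ (e3 ∷ e4 ∷ []) ∷ (e1 ∷ e2 ∷ e3 ∷ e4 ∷ []) ∷ [])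

-- Each of the four set systems is sent by a single handle slide to a set
-- system violating symmetric exchange, so already a one-step sequence of
-- handle slides leaves the class of delta-matroids.
module Submission where

open import Data.Bool using (true; false)
open import Data.Fin using (Fin; zero; suc)
open import Data.Fin.Subset using (Subset; _∈_; _∪_; ⁅_⁆)
open import Data.List using ([]; _∷_)
open import Data.Product using (_×_; _,_; proj₂)
open import Data.Unit using (tt)
open import Data.Vec using ([]; _∷_; here; there)
open import Relation.Binary.PropositionalEquality using (_≢_)
open import Relation.Nullary using (¬_)

open import Defs

exchange-violation⇒¬IsDeltaMatroid :
  ∀ {n} {𝓕 : Family n} (F₁ F₂ : Subset n) → F₁ ∈𝓕 𝓕 → F₂ ∈𝓕 𝓕 →
  (x : Fin n) → x ∈ (F₁ Δ F₂) →
  (∀ y → y ∈ (F₁ Δ F₂) → ¬ (F₁ Δ (⁅ x ⁆ ∪ ⁅ y ⁆)) ∈𝓕 𝓕) →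
  ¬ IsDeltaMatroid 𝓕
exchange-violation⇒¬IsDeltaMatroid F₁ F₂ F₁∈𝓕 F₂∈𝓕 x x∈Δ noExchange (_ , exchange)
  with exchange F₁ F₂ F₁∈𝓕 F₂∈𝓕 x x∈Δ
... | y , y∈Δ , exchanged∈𝓕 = noExchange y y∈Δ exchanged∈𝓕

handleSlide-¬IsDeltaMatroid⇒¬Stable :
  ∀ {n} {𝓕 : Family n} (a b : Fin n) (a≢b : a ≢ b) →
  ¬ IsDeltaMatroid (handleSlide 𝓕 a b) → ¬ StableUnderHandleSlides 𝓕
handleSlide-¬IsDeltaMatroid⇒¬Stable a b a≢b ¬dm stable = ¬dm (stable ((a , b , a≢b) ∷ []))

-- (S₁)₁₂ = {∅, {1,2}, {2,3}, {1,2,3}}; exchange fails for F₁ = E, F₂ = ∅, x = 2.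
S₁-not-stable : ¬ StableUnderHandleSlides S₁
S₁-not-stable = handleSlide-¬IsDeltaMatroid⇒¬Stable e1 e2 (λ ())
  (exchange-violation⇒¬IsDeltaMatroid
    (true ∷ true ∷ true ∷ []) (false ∷ false ∷ false ∷ []) tt tt e2 (there here)
    λ { zero _ () ; (suc zero) _ () ; (suc (suc zero)) _ () })

-- (S₂)₁₂ = {∅, {2}, {3}, {1,2}, {2,3}}; exchange fails for F₁ = {3}, F₂ = {1,2}, x = 1.
S₂-not-stable : ¬ StableUnderHandleSlides S₂
S₂-not-stable = handleSlide-¬IsDeltaMatroid⇒¬Stable e1 e2 (λ ())
  (exchange-violation⇒¬IsDeltaMatroid
    (false ∷ false ∷ true ∷ []) (true ∷ true ∷ false ∷ []) tt tt e1 here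
    λ { zero _ () ; (suc zero) _ () ; (suc (suc zero)) _ () })

-- (S₃)₂₃ = {∅, {3}, {1,3}, {1,2,3}}; exchange fails for F₁ = ∅, F₂ = E, x = 2.
S₃-not-stable : ¬ StableUnderHandleSlides S₃
S₃-not-stable = handleSlide-¬IsDeltaMatroid⇒¬Stable e2 e3 (λ ())
  (exchange-violation⇒¬IsDeltaMatroid
    (false ∷ false ∷ false ∷ []) (true ∷ true ∷ true ∷ []) tt tt e2 (there here)
    λ { zero _ () ; (suc zero) _ () ; (suc (suc zero)) _ () })

-- (S₅)₁₃ = {∅, {2,3}, {3,4}, {1,2,3,4}}; exchange fails for F₁ = ∅, F₂ = E, x = 1.
S₅-not-stable : ¬ StableUnderHandleSlides S₅
S₅-not-stable = handleSlide-¬IsDeltaMatroid⇒¬Stable e1 e3 (λ ())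
  (exchange-violation⇒¬IsDeltaMatroid
    (false ∷ false ∷ false ∷ false ∷ []) (true ∷ true ∷ true ∷ true ∷ []) tt tt e1 here
    λ { zero _ () ; (suc zero) _ () ; (suc (suc zero)) _ () ; (suc (suc (suc zero))) _ () })

proposition3p1 : ¬ StableUnderHandleSlides S₁ × ¬ StableUnderHandleSlides S₂ ×
                 ¬ StableUnderHandleSlides S₃ × ¬ StableUnderHandleSlides S₅
proposition3p1 = S₁-not-stable , S₂-not-stable , S₃-not-stable , S₅-not-stable
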